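{- A tournament $T$ on $\{1,\ldots,n\}$ is alternation acyclic if and only if the right-alternating walk relation $\preceq$ induced by $T$ is a partial order on $\{1,\ldots,n\}$.
   Context: A tournament on $\{1,\ldots,n\}$ is a directed graph on $\{1,\ldots,n\}$ with, for each pair $i\neq j$, exactly one of the arcs $i\to j$, $j\to i$. An arc $i\to j$ is an ascent if $i<j$ and a descent if $i>j$. A directed cycle is alternating if ascents and descents alternate along it (cyclically); $T$ is alternation acyclic if it has no alternating directed cycle. The right-alternating walk relation: $u\preceq v$ if $u=v$ or there is a directed walk $u=w_0\to w_1\to w_2\to\cdots\to w_{2i-1}\to w_{2i}=v$ ($i\geq 1$) in which the arcs $w_{2r}\to w_{2r+1}$ are descents and the arcs $w_{2r+1}\to w_{2r+2}$ are ascents (so the first arc is a descent and the last an ascent). -}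

module Defs where

open import Data.Nat using (ℕ; zero; suc; _≤_) renaming (_<_ to _<ℕ_)
open import Data.Nat.Properties using (_<?_)
open import Data.Fin using (Fin; zero; suc; toℕ; fromℕ<; _<_)
open import Data.Product using (_×_; Σ; ∃)
open import Data.Sum using (_⊎_)
open import Data.Empty using (⊥)
open import Relation.Nullary using (¬_; yes; no)
open import Relation.Binary.PropositionalEquality using (_≡_; _≢_)
open import Function.Definitions using (Injective)

-- Vertices 1..n are represented by Fin n (vertex i+1 ↔ i : Fin n); the
-- natural order on Fin n (via toℕ) is the order on {1,…,n}.

record Tournament (n : ℕ) : Set₁ where
  field
    Arc      : Fin n → Fin n → Set
    loopless : ∀ i → ¬ Arc i i
    total    : ∀ i j → i ≢ j → Arc i j ⊎ Arc j i
    asym     : ∀ i j → Arc i j → Arc j i → ⊥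

module _ {n : ℕ} (T : Tournament n) where
  open Tournament T

  Ascent : Fin n → Fin n → Set
  Ascent i j = Arc i j × i < j

  Descent : Fin n → Fin n → Set
  Descent i j = Arc i j × j < i

  data RAWalk : Fin n → Fin n → Set where
    last : ∀ {u w v} → Descent u w → Ascent w v → RAWalk u v
    more : ∀ {u w x v} → Descent u w → Ascent w x → RAWalk x v → RAWalk u v

  _⪯_ : Fin n → Fin n → Set
  u ⪯ v = u ≡ v ⊎ RAWalk u v

next : ∀ {m} → Fin (suc m) → Fin (suc m)
next {m} i with suc (toℕ i) <? suc m
... | yes p = fromℕ< p
... | no _  = zero

module _ {n : ℕ} (T : Tournament n) where
  open Tournament T

  record DirectedCycle : Set where
    field
      m      : ℕ
      len≥2  : 1 ≤ m
      c      : Fin (suc m) → Fin n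
      distinct : Injective _≡_ _≡_ c
      arcs   : ∀ j → Arc (c j) (c (next j))

  Alternating : DirectedCycle → Set
  Alternating C =
    ∀ j → (Ascent T (c j) (c (next j)) × Descent T (c (next j)) (c (next (next j))))
        ⊎ (Descent T (c j) (c (next j)) × Ascent T (c (next j)) (c (next (next j))))
    where open DirectedCycle C

  AlternationAcyclic : Set
  AlternationAcyclic = ¬ Σ DirectedCycle Alternating

module Submission where

open import Defs
open import Data.Nat using (ℕ)
open import Data.Fin using (Fin)
open import Relation.Binary.PropositionalEquality using (_≡_)
open import Relation.Binary.Structures using (IsPartialOrder)
open import Function.Bundles using (_⇔_)

open import Data.Nat using (zero; suc; _+_; _∸_; s≤s; z≤n)
import Data.Nat.Properties as ℕ
open import Data.Fin using (zero; suc; toℕ; _<_; _<?_)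
import Data.Fin.Properties as Fin
open import Data.Product using (_×_; Σ; Σ-syntax; _,_; proj₁; proj₂)
open import Data.Sum using (_⊎_; inj₁; inj₂)
open import Data.Empty using (⊥; ⊥-elim)
open import Relation.Nullary using (¬_; yes; no)
open import Relation.Binary.Definitions using (Antisymmetric)
open import Relation.Binary.PropositionalEquality using (refl; sym; subst; isEquivalence; _≢_)
open import Relation.Binary.Structures using (IsPreorder)
open import Function.Bundles using (mk⇔)

-- A right-alternating walk is a concatenation of descent–ascent pairs, so ⪯ is always a preorder,
-- and it is a partial order exactly when there is no closed right-alternating walk.
-- If T is alternation acyclic, two consecutive pairs u ↘ · ↗ · ↘ · ↗ v can always be replaced by
-- a single pair u ↘ · ↗ v, since otherwise an alternating 4-cycle appears; so a closed walk would
-- shrink to x ↘ w ↗ x, contradicting asymmetry. Conversely, an alternating cycle, read from a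
-- descent on in steps of two arcs, yields a closed right-alternating walk.

module _ {n : ℕ} (T : Tournament n) where
  open Tournament T

  Valley : Fin n → Fin n → Set
  Valley u v = Σ[ w ∈ Fin n ] Descent T u w × Ascent T w v

  valley⇒RAWalk : ∀ {u v} → Valley u v → RAWalk T u v
  valley⇒RAWalk (_ , d , a) = last d a

  RAWalk-trans : ∀ {u v w} → RAWalk T u v → RAWalk T v w → RAWalk T u w
  RAWalk-trans (last d a)   q = more d a q
  RAWalk-trans (more d a p) q = more d a (RAWalk-trans p q)

  ⪯-isPreorder : IsPreorder {A = Fin n} _≡_ (_⪯_ T)
  ⪯-isPreorder = record
    { isEquivalence = isEquivalence
    ; reflexive     = inj₁
    ; trans         = trans
    }
    where
    trans : ∀ {i j k} → _⪯_ T i j → _⪯_ T j k → _⪯_ T i k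
    trans (inj₁ refl) q           = q
    trans (inj₂ p)    (inj₁ refl) = inj₂ p
    trans (inj₂ p)    (inj₂ q)    = inj₂ (RAWalk-trans p q)

  ¬closedValley : ∀ {x} → ¬ Valley x x
  ¬closedValley {x} (w , d , a) = asym x w (proj₁ d) (proj₁ a)

  noClosedRAWalk⇒antisym : (∀ {x} → ¬ RAWalk T x x) → Antisymmetric _≡_ (_⪯_ T)
  noClosedRAWalk⇒antisym _        (inj₁ i≡j) _          = i≡j
  noClosedRAWalk⇒antisym _        (inj₂ _)   (inj₁ j≡i) = sym j≡i
  noClosedRAWalk⇒antisym noClosed (inj₂ p)   (inj₂ q)   = ⊥-elim (noClosed (RAWalk-trans p q))

  antisym⇒noClosedRAWalk : Antisymmetric _≡_ (_⪯_ T) → ∀ {x} → ¬ RAWalk T x x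
  antisym⇒noClosedRAWalk _       (last d a) = ¬closedValley (_ , d , a)
  antisym⇒noClosedRAWalk antisym (more d a p) with antisym (inj₂ (last d a)) (inj₂ p)
  ... | refl = ¬closedValley (_ , d , a)

  arc⇒≢ : ∀ {i j} → Arc i j → i ≢ j
  arc⇒≢ {i} p refl = loopless i p

  orient : ∀ {i j} → i < j → Arc i j ⊎ Arc j i
  orient i<j = total _ _ (Fin.<⇒≢ i<j)

  AlternatingCycle : Set
  AlternatingCycle = Σ (DirectedCycle T) (Alternating T)

  alternating4Cycle : ∀ {a b c d} → Descent T a b → Ascent T b c → Descent T c d → Ascent T d a →
                      AlternatingCycle
  alternating4Cycle {a} {b} {c} {d} ab bc cd da = cycle , alternating
    where
    vertex : Fin 4 → Fin n
    vertex zero                   = a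
    vertex (suc zero)             = b
    vertex (suc (suc zero))       = c
    vertex (suc (suc (suc zero))) = d

    a≢b : a ≢ b
    a≢b = arc⇒≢ (proj₁ ab)
    b≢c : b ≢ c
    b≢c = arc⇒≢ (proj₁ bc)
    c≢d : c ≢ d
    c≢d = arc⇒≢ (proj₁ cd)
    d≢a : d ≢ a
    d≢a = arc⇒≢ (proj₁ da)
    a≢c : a ≢ c
    a≢c refl = asym b a (proj₁ bc) (proj₁ ab)
    b≢d : b ≢ d
    b≢d refl = asym b c (proj₁ bc) (proj₁ cd)

    injective : ∀ x y → vertex x ≡ vertex y → x ≡ y
    injective zero                   zero                   _ = refl
    injective zero                   (suc zero)             e = ⊥-elim (a≢b e)
    injective zero                   (suc (suc zero))       e = ⊥-elim (a≢c e)
    injective zero                   (suc (suc (suc zero))) e = ⊥-elim (d≢a (sym e))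
    injective (suc zero)             zero                   e = ⊥-elim (a≢b (sym e))
    injective (suc zero)             (suc zero)             _ = refl
    injective (suc zero)             (suc (suc zero))       e = ⊥-elim (b≢c e)
    injective (suc zero)             (suc (suc (suc zero))) e = ⊥-elim (b≢d e)
    injective (suc (suc zero))       zero                   e = ⊥-elim (a≢c (sym e))
    injective (suc (suc zero))       (suc zero)             e = ⊥-elim (b≢c (sym e))
    injective (suc (suc zero))       (suc (suc zero))       _ = refl
    injective (suc (suc zero))       (suc (suc (suc zero))) e = ⊥-elim (c≢d e)
    injective (suc (suc (suc zero))) zero                   e = ⊥-elim (d≢a e)
    injective (suc (suc (suc zero))) (suc zero)             e = ⊥-elim (b≢d (sym e))
    injective (suc (suc (suc zero))) (suc (suc zero))       e = ⊥-elim (c≢d (sym e))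
    injective (suc (suc (suc zero))) (suc (suc (suc zero))) _ = refl

    arcs : ∀ j → Arc (vertex j) (vertex (next j))
    arcs zero                   = proj₁ ab
    arcs (suc zero)             = proj₁ bc
    arcs (suc (suc zero))       = proj₁ cd
    arcs (suc (suc (suc zero))) = proj₁ da

    cycle : DirectedCycle T
    cycle = record
      { m = 3 ; len≥2 = s≤s z≤n ; c = vertex ; distinct = λ {x} {y} → injective x y ; arcs = arcs }

    alternating : Alternating T cycle
    alternating zero                   = inj₂ (ab , bc)
    alternating (suc zero)             = inj₁ (bc , cd)
    alternating (suc (suc zero))       = inj₂ (cd , da)
    alternating (suc (suc (suc zero))) = inj₁ (da , ab)

  -- Decide the arc between v₃ and v₀ if v₃ < v₀, and otherwise the arc between v₁ and v₄
  -- (then v₁ < v₀ ≤ v₃ < v₄); one orientation is the shortcut, the other closes a 4-cycle.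
  valleyOrAlternatingCycle : ∀ {v₀ v₁ v₂ v₃ v₄} →
    Descent T v₀ v₁ → Ascent T v₁ v₂ → Descent T v₂ v₃ → Ascent T v₃ v₄ →
    Valley v₀ v₄ ⊎ AlternatingCycle
  valleyOrAlternatingCycle {v₀} {v₁} {_} {v₃} d₀₁ a₁₂ d₂₃ a₃₄ with v₃ <? v₀
  ... | yes v₃<v₀ with orient v₃<v₀
  ...   | inj₁ v₃→v₀ = inj₂ (alternating4Cycle d₀₁ a₁₂ d₂₃ (v₃→v₀ , v₃<v₀))
  ...   | inj₂ v₀→v₃ = inj₁ (v₃ , (v₀→v₃ , v₃<v₀) , a₃₄)
  valleyOrAlternatingCycle {v₀} {v₁} {_} {v₃} d₀₁ a₁₂ d₂₃ a₃₄ | no v₃≮v₀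
    with v₁<v₄ ← Fin.<-trans (proj₂ d₀₁) (ℕ.≤-<-trans (ℕ.≮⇒≥ v₃≮v₀) (proj₂ a₃₄))
    with orient v₁<v₄
  ... | inj₁ v₁→v₄ = inj₁ (v₁ , d₀₁ , (v₁→v₄ , v₁<v₄))
  ... | inj₂ v₄→v₁ = inj₂ (alternating4Cycle d₂₃ a₃₄ (v₄→v₁ , v₁<v₄) a₁₂)

  RAWalk⇒valley : AlternationAcyclic T → ∀ {u v} → RAWalk T u v → Valley u v
  RAWalk⇒valley _       (last d a) = _ , d , a
  RAWalk⇒valley acyclic (more d a p) with RAWalk⇒valley acyclic p
  ... | _ , d′ , a′ with valleyOrAlternatingCycle d a d′ a′
  ...   | inj₁ valley = valley
  ...   | inj₂ cycle  = ⊥-elim (acyclic cycle)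

  acyclic⇒noClosedRAWalk : AlternationAcyclic T → ∀ {x} → ¬ RAWalk T x x
  acyclic⇒noClosedRAWalk acyclic p = ¬closedValley (RAWalk⇒valley acyclic p)

  module _ (C : DirectedCycle T) (alternating : Alternating T C) where
    open DirectedCycle C

    DescentAt : Fin (suc m) → Set
    DescentAt k = Descent T (c k) (c (next k))

    firstDescent : Σ (Fin (suc m)) DescentAt
    firstDescent with alternating zero
    ... | inj₁ (_ , d) = next zero , d
    ... | inj₂ (d , _) = zero , d

    descent⇒ascent×descent : ∀ k → DescentAt k →
      Ascent T (c (next k)) (c (next (next k))) × DescentAt (next (next k))
    descent⇒ascent×descent k dₖ with alternating k
    ... | inj₁ (aₖ , _) = ⊥-elim (Fin.<-asym (proj₂ aₖ) (proj₂ dₖ))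
    ... | inj₂ (_ , a) with alternating (next k)
    ...   | inj₁ (_ , d) = a , d
    ...   | inj₂ (d , _) = ⊥-elim (Fin.<-asym (proj₂ a) (proj₂ d))

    descentIndex : ℕ → Σ (Fin (suc m)) DescentAt
    descentIndex zero    = firstDescent
    descentIndex (suc t) with descentIndex t
    ... | k , dₖ = next (next k) , proj₂ (descent⇒ascent×descent k dₖ)

    vertexAt : ℕ → Fin n
    vertexAt t = c (proj₁ (descentIndex t))

    valleyAt : ∀ t → Valley (vertexAt t) (vertexAt (suc t))
    valleyAt t with descentIndex t
    ... | k , dₖ = c (next k) , dₖ , proj₁ (descent⇒ascent×descent k dₖ)

    walkFrom : ∀ s k → RAWalk T (vertexAt s) (vertexAt (k + suc s))
    walkFrom s zero    = valley⇒RAWalk (valleyAt s)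
    walkFrom s (suc k) = RAWalk-trans (walkFrom s k) (valley⇒RAWalk (valleyAt (k + suc s)))

    alternatingCycle⇒closedRAWalk : Σ[ x ∈ Fin n ] RAWalk T x x
    alternatingCycle⇒closedRAWalk
      with i , j , i<j , same ← Fin.pigeonhole (ℕ.n<1+n n) (λ t → vertexAt (toℕ t)) =
      vertexAt (toℕ i) ,
      subst (RAWalk T (vertexAt (toℕ i))) (sym same)
        (subst (λ t → RAWalk T (vertexAt (toℕ i)) (vertexAt t)) (ℕ.m∸n+n≡m i<j)
          (walkFrom (toℕ i) (toℕ j ∸ suc (toℕ i))))

proposition2p5 : (n : ℕ) (T : Tournament n) →
    AlternationAcyclic T ⇔ IsPartialOrder {A = Fin n} _≡_ (_⪯_ T)
proposition2p5 n T = mk⇔ acyclic⇒partialOrder partialOrder⇒acyclic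
  where
  acyclic⇒partialOrder : AlternationAcyclic T → IsPartialOrder _≡_ (_⪯_ T)
  acyclic⇒partialOrder acyclic = record
    { isPreorder = ⪯-isPreorder T
    ; antisym    = noClosedRAWalk⇒antisym T (acyclic⇒noClosedRAWalk T acyclic)
    }

  partialOrder⇒acyclic : IsPartialOrder _≡_ (_⪯_ T) → AlternationAcyclic T
  partialOrder⇒acyclic partialOrder (C , alternating) =
    antisym⇒noClosedRAWalk T (IsPartialOrder.antisym partialOrder) closedWalk
    where closedWalk = proj₂ (alternatingCycle⇒closedRAWalk T C alternating)
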